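{- Let $D$ be an orientation of $K_{m,n}$ and let $u,v$ be adjacent vertices in $C_{1,2}(D)$. Then $u$ and $v$ belong to the same partite set of $K_{m,n}$ if and only if $u$ and $v$ compete in $D$.
   Context: Two vertices $u,v$ of a digraph compete if they have a common out-neighbor. For vertices $x,y$ of a digraph $H$, $d_H(x,y)$ is the length of a shortest directed $(x,y)$-path. The $(1,2)$-step competition graph $C_{1,2}(D)$ is the simple graph on $V(D)$ in which distinct $u,v$ are adjacent iff there is $w\neq u,v$ with either $d_{D-v}(u,w)\le 1$ and $d_{D-u}(v,w)\le 2$, or $d_{D-u}(v,w)\le 1$ and $d_{D-v}(u,w)\le 2$. -}

module Defs where

open import Data.Nat using (ℕ; zero; suc)
open import Data.Fin using (Fin)
open import Data.Bool using (Bool; true; false)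
open import Data.Sum using (_⊎_; inj₁; inj₂)
open import Data.Product using (_×_; ∃-syntax)
open import Data.Empty using (⊥)
open import Data.Unit using (⊤)
open import Relation.Binary.PropositionalEquality using (_≡_; _≢_)

Digraph : Set → Set₁
Digraph V = V → V → Set

-- Vertices of K_{m,n}: left part Fin m, right part Fin n.
Vtx : ℕ → ℕ → Set
Vtx m n = Fin m ⊎ Fin n

-- An orientation of K_{m,n}: for each edge {i,j} (i in left part, j in right
-- part) a choice of direction: true means i → j, false means j → i.
Orientation : ℕ → ℕ → Set
Orientation m n = Fin m → Fin n → Bool

arcOf : ∀ {m n} → Orientation m n → Digraph (Vtx m n)
arcOf o (inj₁ i) (inj₁ i′) = ⊥
arcOf o (inj₁ i) (inj₂ j)  = o i j ≡ true
arcOf o (inj₂ j) (inj₁ i)  = o i j ≡ false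
arcOf o (inj₂ j) (inj₂ j′) = ⊥

-- Reach A z k x y : there is a directed (x,y)-walk of length at most k in
-- the digraph A − z (all vertices of the walk differ from z).
-- Hence  Reach A z k x y  iff  d_{A−z}(x,y) ≤ k.
data Reach {V : Set} (A : Digraph V) (z : V) : ℕ → V → V → Set where
  here : ∀ {k x} → x ≢ z → Reach A z k x x
  step : ∀ {k x y w} → x ≢ z → A x y → Reach A z k y w → Reach A z (suc k) x w

C12Adj : ∀ {V : Set} → Digraph V → V → V → Set
C12Adj A u v =
  u ≢ v ×
  ∃[ w ] (w ≢ u × w ≢ v ×
          ((Reach A v 1 u w × Reach A u 2 v w) ⊎
           (Reach A u 1 v w × Reach A v 2 u w)))

Compete : ∀ {V : Set} → Digraph V → V → V → Set
Compete A u v = ∃[ w ] (A u w × A v w)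

SamePart : ∀ {m n} → Vtx m n → Vtx m n → Set
SamePart (inj₁ _) (inj₁ _) = ⊤

SamePart (inj₂ _) (inj₂ _) = ⊤

SamePart _ _ = ⊥

-- Every arc of an orientation of K_{m,n} changes sides, so a walk of length two
-- returns to the side it started from. If u and v lie on the same side and u → w,
-- then w is on the other side, so the walk of length at most two from v to w
-- cannot have length two: it is a single arc v → w, and w is a common
-- out-neighbour. Conversely, a common out-neighbour puts u and v on the side
-- opposite to it.
module Submission where

open import Defs
open import Data.Nat using (ℕ)
open import Data.Bool using (Bool; true; false; not)
open import Data.Bool.Properties using (not-injective; not-involutive; not-¬)
open import Data.Sum using (_⊎_; inj₁; inj₂)
open import Data.Product using (_×_; _,_; ∃-syntax; map₂; swap)
open import Data.Empty using (⊥-elim)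
open import Data.Unit using (tt)
open import Function.Bundles using (_⇔_; mk⇔; Equivalence)
open import Relation.Binary.PropositionalEquality

Bipartite : {V : Set} → Digraph V → (V → Bool) → Set
Bipartite A side = ∀ {x y} → A x y → side y ≡ not (side x)

module _ {V : Set} {A : Digraph V} {side : V → Bool} (bip : Bipartite A side) where

  compete⇒sameSide : ∀ {u v} → Compete A u v → side u ≡ side v
  compete⇒sameSide (w , uw , vw) = not-injective (trans (sym (bip uw)) (bip vw))

  twoStep⇒sameSide : ∀ {x y w} → A x y → A y w → side x ≡ side w
  twoStep⇒sameSide {x} {y} {w} xy yw = sym (begin
    side w             ≡⟨ bip yw ⟩
    not (side y)       ≡⟨ cong not (bip xy) ⟩
    not (not (side x)) ≡⟨ not-involutive (side x) ⟩
    side x             ∎)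
    where open ≡-Reasoning

  arc∧walk≤2⇒compete : ∀ {u v w} → side u ≡ side v →
    A u w → A v w ⊎ ∃[ y ] (A v y × A y w) → Compete A u v
  arc∧walk≤2⇒compete _  uw (inj₁ vw) = _ , uw , vw
  arc∧walk≤2⇒compete eq uw (inj₂ (_ , vy , yw)) =
    ⊥-elim (not-¬ (sym (trans eq (twoStep⇒sameSide vy yw))) (bip uw))

Reach-1⇒arc : ∀ {V : Set} {A : Digraph V} {z x w} →
  Reach A z 1 x w → w ≢ x → A x w
Reach-1⇒arc (here _)             w≢x = ⊥-elim (w≢x refl)
Reach-1⇒arc (step _ xw (here _)) _   = xw

Reach-2⇒walk : ∀ {V : Set} {A : Digraph V} {z x w} →
  Reach A z 2 x w → w ≢ x → A x w ⊎ ∃[ y ] (A x y × A y w)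
Reach-2⇒walk (here _)                          w≢x = ⊥-elim (w≢x refl)
Reach-2⇒walk (step _ xw (here _))              _   = inj₁ xw
Reach-2⇒walk (step _ xy (step _ yw (here _)))  _   = inj₂ (_ , xy , yw)

C12Adj∧sameSide⇒compete : ∀ {V : Set} {A : Digraph V} {side : V → Bool} →
  Bipartite A side → ∀ {u v} → C12Adj A u v → side u ≡ side v → Compete A u v
C12Adj∧sameSide⇒compete bip (_ , w , w≢u , w≢v , inj₁ (uw , vw)) eq =
  arc∧walk≤2⇒compete bip eq (Reach-1⇒arc uw w≢u) (Reach-2⇒walk vw w≢v)
C12Adj∧sameSide⇒compete bip (_ , w , w≢u , w≢v , inj₂ (vw , uw)) eq =
  map₂ swap (arc∧walk≤2⇒compete bip (sym eq) (Reach-1⇒arc vw w≢v) (Reach-2⇒walk uw w≢u))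

side : ∀ {m n} → Vtx m n → Bool
side (inj₁ _) = true
side (inj₂ _) = false

arcOf-bipartite : ∀ {m n} (o : Orientation m n) → Bipartite (arcOf o) side
arcOf-bipartite o {inj₁ _} {inj₂ _} _ = refl
arcOf-bipartite o {inj₂ _} {inj₁ _} _ = refl

SamePart⇔sameSide : ∀ {m n} (x y : Vtx m n) → SamePart x y ⇔ side x ≡ side y
SamePart⇔sameSide (inj₁ _) (inj₁ _) = mk⇔ (λ _ → refl) (λ _ → tt)
SamePart⇔sameSide (inj₂ _) (inj₂ _) = mk⇔ (λ _ → refl) (λ _ → tt)
SamePart⇔sameSide (inj₁ _) (inj₂ _) = mk⇔ (λ ()) (λ ())
SamePart⇔sameSide (inj₂ _) (inj₁ _) = mk⇔ (λ ()) (λ ())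

proposition2p2 : (m n : ℕ) (o : Orientation m n) (u v : Vtx m n) →
    C12Adj (arcOf o) u v →
    SamePart u v ⇔ Compete (arcOf o) u v
proposition2p2 m n o u v adj = mk⇔
  (λ same → C12Adj∧sameSide⇒compete bip adj (to same))
  (λ comp → from (compete⇒sameSide {side = side} bip comp))
  where
  bip : Bipartite (arcOf o) side
  bip = arcOf-bipartite o
  open Equivalence (SamePart⇔sameSide u v)
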